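{- Let $L=\mathrm{Log}(\mathcal F)$ be a tabular quasi-normal modal logic, $\mathcal F$ a finite set of finite frames each rooted at $0$. Let $\varphi$ be a modal formula and $\sigma\subseteq\mathrm{sig}(\varphi)$. For each $\mathfrak F\in\mathcal F$ let $\xi_{\mathfrak F}\in\mathrm{PL}(\sigma_{\mathfrak F})$ be a propositional uniform $\sigma_{\mathfrak F}$-interpolant for $\mathit{tr}_{\mathfrak F,0}(\varphi)$. Then $\bigvee_{\mathfrak F\in\mathcal F}\mathit{rt}_{\mathfrak F,L}(\xi_{\mathfrak F})$ is a strongest $L(\sigma)$-implicate of $\varphi$.
   Context: For $\mathfrak F=(W,R)$: $\sigma'_{\mathfrak F}=\{p_w:p\in\sigma',w\in W\}$; $\mathit{tr}_{\mathfrak F,w}$: $p\mapsto p_w$, commutes with $\top,\neg,\wedge$, $\Diamond\varphi\mapsto\bigvee_{(w,w')\in R}\mathit{tr}_{\mathfrak F,w'}(\varphi)$ ($\Box=\neg\Diamond\neg$). Let $N=\max_{\mathfrak G\in\mathcal F}|\mathfrak G|$, $\Box^{\le N}\psi=\psi\wedge\Box\psi\wedge\dots\wedge\Box^N\psi$, $\Diamond^{\le N}=\neg\Box^{\le N}\neg$. $\sigma$-EME: finite pairwise inconsistent set $\Phi$ of propositional formulas over $\sigma$ with tautological disjunction; $\sigma$-cover of a model: worlds satisfying the same member agree on $\sigma$. $\mathit{cover}(\sigma,\Phi)=\bigwedge_{\phi\in\Phi}\bigwedge_{p\in\sigma}(\Diamond^{\le N}(\phi\wedge p)\to\Box^{\le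 N}(\phi\to p))$. Abstract $\Phi$-model for $L$: $(\mathfrak G,f)$, $\mathfrak G\in\mathcal F$, $f$ from worlds to $\Phi$; formulas over $\Phi$ treat its members as atoms ($w\models\phi$ iff $f(w)=\phi$); abstract $\Phi$-bisimulations satisfy Forth, Back and equal $f$-values on related worlds. An abstract class identifier is a formula $\delta$ over $\Phi$ such that the abstract $\Phi$-models for $L$ satisfying $\delta$ at the root form exactly one class of abstract-$\Phi$-bisimilarity at roots, denoted $[\delta]_L$. A $\sigma$-encoding for $L$: $(\Gamma,\{\Delta_\Phi\}_{\Phi\in\Gamma})$, $\Gamma$ a set of $\sigma$-EMEs, $\Delta_\Phi$ sets of abstract class identifiers, such that each model on a frame in $\mathcal F$ has a $\sigma$-cover $\Phi\in\Gamma$ and some $\delta\in\Delta_\Phi$ true at its root. With a fixed $\sigma$-encoding, $\mathit{rt}_{\mathfrak F,L}(\xi)=\bigwedge_{\Phi\in\Gamma}\bigwedge_{\delta\in\Delta_\Phi}((\mathit{cover}(\sigma,\Phi)\wedge\delta)\to\bigvee_{(\mathfrak F,f)\in[\delta]_L}\xi^f)$ (disjunction over members of $[\delta]_L$ based on $\mathfrak F$), $\xi^f$ obtained by replacing $p_w$ by $\Diamond^{\le N}(f(w)\wedge p)$. Propositional uniform $S$-interpolant of $\xi'$: propositional $\chi$ over $S$, $\xi'\to\chi$ tautology, $\chi\to\psi$ tautology whenever $\mathrm{sig}(\psi)\cap\mathrm{sig}(\xi')\subseteq S$ and $\xi'\to\psi$ tautology. Strongest $L(\sigma)$-implicate of $\varphi$: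 modal $\chi$, $\mathrm{sig}(\chi)\subseteq\sigma$, $\varphi\to\chi\in L$, $\chi\to\psi\in L$ whenever $\mathrm{sig}(\psi)\subseteq\sigma$ and $\varphi\to\psi\in L$. $\mathrm{Log}(\mathcal F)$: formulas true at the root of every model on every frame of $\mathcal F$. -}

module Defs where

open import Data.Nat using (ℕ; zero; suc; _⊔_)
open import Data.Fin using (Fin; zero; suc; _≟_)
open import Data.Bool using (Bool; true; false; not; _∧_; _∨_)
open import Data.List using (List; []; _∷_; _++_; map; concatMap; filterᵇ; foldr; length; lookup; tabulate; allFin)
open import Data.List.Membership.Propositional using (_∈_)
open import Data.Product using (Σ; _×_; _,_; proj₁; proj₂; ∃)
open import Relation.Binary.PropositionalEquality using (_≡_; _≢_)
open import Relation.Nullary.Decidable using (⌊_⌋)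

data PL (A : Set) : Set where
  pv   : A → PL A
  ⊤ₚ   : PL A
  ¬ₚ_  : PL A → PL A
  _∧ₚ_ : PL A → PL A → PL A

⊥ₚ : ∀ {A} → PL A
⊥ₚ = ¬ₚ ⊤ₚ

_∨ₚ_ : ∀ {A} → PL A → PL A → PL A
a ∨ₚ b = ¬ₚ ((¬ₚ a) ∧ₚ (¬ₚ b))

_⇒ₚ_ : ∀ {A} → PL A → PL A → PL A
a ⇒ₚ b = ¬ₚ (a ∧ₚ (¬ₚ b))

⋁ₚ : ∀ {A} → List (PL A) → PL A
⋁ₚ = foldr _∨ₚ_ ⊥ₚ

sigₚ : ∀ {A} → PL A → List A
sigₚ (pv a) = a ∷ []
sigₚ ⊤ₚ = []
sigₚ (¬ₚ a) = sigₚ a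
sigₚ (a ∧ₚ b) = sigₚ a ++ sigₚ b

evalₚ : ∀ {A} → (A → Bool) → PL A → Bool
evalₚ v (pv a) = v a
evalₚ v ⊤ₚ = true
evalₚ v (¬ₚ a) = not (evalₚ v a)
evalₚ v (a ∧ₚ b) = evalₚ v a ∧ evalₚ v b

Taut : ∀ {A} → PL A → Set
Taut {A} a = (v : A → Bool) → evalₚ v a ≡ true

data Fm (A : Set) : Set where
  var  : A → Fm A
  ⊤ₘ   : Fm A
  ¬ₘ_  : Fm A → Fm A
  _∧ₘ_ : Fm A → Fm A → Fm A
  ◇_   : Fm A → Fm A

⊥ₘ : ∀ {A} → Fm A
⊥ₘ = ¬ₘ ⊤ₘ

_∨ₘ_ : ∀ {A} → Fm A → Fm A → Fm A
a ∨ₘ b = ¬ₘ ((¬ₘ a) ∧ₘ (¬ₘ b))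

_⇒ₘ_ : ∀ {A} → Fm A → Fm A → Fm A
a ⇒ₘ b = ¬ₘ (a ∧ₘ (¬ₘ b))

□_ : ∀ {A} → Fm A → Fm A
□ a = ¬ₘ (◇ (¬ₘ a))

⋀ₘ : ∀ {A} → List (Fm A) → Fm A
⋀ₘ = foldr _∧ₘ_ ⊤ₘ

⋁ₘ : ∀ {A} → List (Fm A) → Fm A
⋁ₘ = foldr _∨ₘ_ ⊥ₘ

□^ : ∀ {A} → ℕ → Fm A → Fm A
□^ zero a = a
□^ (suc k) a = □ (□^ k a)

□≤ : ∀ {A} → ℕ → Fm A → Fm A
□≤ zero a = a
□≤ (suc k) a = □≤ k a ∧ₘ □^ (suc k) a

◇≤ : ∀ {A} → ℕ → Fm A → Fm A
◇≤ N a = ¬ₘ (□≤ N (¬ₘ a))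

sig : ∀ {A} → Fm A → List A
sig (var a) = a ∷ []
sig ⊤ₘ = []
sig (¬ₘ a) = sig a
sig (a ∧ₘ b) = sig a ++ sig b
sig (◇ a) = sig a

substₘ : ∀ {A B} → (A → Fm B) → Fm A → Fm B
substₘ s (var a) = s a
substₘ s ⊤ₘ = ⊤ₘ
substₘ s (¬ₘ a) = ¬ₘ substₘ s a
substₘ s (a ∧ₘ b) = substₘ s a ∧ₘ substₘ s b
substₘ s (◇ a) = ◇ substₘ s a

substₚ : ∀ {A B} → (A → Fm B) → PL A → Fm B
substₚ s (pv a) = s a
substₚ s ⊤ₚ = ⊤ₘ
substₚ s (¬ₚ a) = ¬ₘ substₚ s a
substₚ s (a ∧ₚ b) = substₚ s a ∧ₘ substₚ s b

emb : ∀ {A} → PL A → Fm A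
emb = substₚ var

record Frame : Set where
  field
    n : ℕ
    R : Fin (suc n) → Fin (suc n) → Bool

W : Frame → Set
W F = Fin (suc (Frame.n F))

card : Frame → ℕ
card F = suc (Frame.n F)

root : (F : Frame) → W F
root F = zero

data Reach (F : Frame) : W F → W F → Set where
  here : ∀ {w} → Reach F w w
  step : ∀ {w u w'} → Frame.R F w u ≡ true → Reach F u w' → Reach F w w'

Rooted : Frame → Set
Rooted F = (w : W F) → Reach F (root F) w

anyFin : ∀ {k} → (Fin k → Bool) → Bool
anyFin {zero} f = false
anyFin {suc k} f = f zero ∨ anyFin (λ i → f (suc i))

eval : ∀ {A} (F : Frame) → (A → W F → Bool) → W F → Fm A → Bool
eval F V w (var a) = V a w
eval F V w ⊤ₘ = true
eval F V w (¬ₘ a) = not (eval F V w a)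
eval F V w (a ∧ₘ b) = eval F V w a ∧ eval F V w b
eval F V w (◇ a) = anyFin (λ w' → Frame.R F w w' ∧ eval F V w' a)

InLog : List Frame → Fm ℕ → Set
InLog ℱ φ = (F : Frame) → F ∈ ℱ → (V : ℕ → W F → Bool) → eval F V (root F) φ ≡ true

maxSize : List Frame → ℕ
maxSize ℱ = foldr _⊔_ 0 (map card ℱ)

tr : (F : Frame) → W F → Fm ℕ → PL (ℕ × W F)
tr F w (var p) = pv (p , w)
tr F w ⊤ₘ = ⊤ₚ
tr F w (¬ₘ a) = ¬ₚ tr F w a
tr F w (a ∧ₘ b) = tr F w a ∧ₚ tr F w b
tr F w (◇ a) = ⋁ₚ (map (λ w' → tr F w' a) (filterᵇ (Frame.R F w) (allFin (card F))))

-- membership in σ_𝔉 = { p_w : p ∈ σ, w ∈ W }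
σ_ : (σ : List ℕ) (F : Frame) → ℕ × W F → Set
σ_ σ F (p , w) = p ∈ σ

IsUnifInterp : ∀ {A} → (A → Set) → PL A → PL A → Set
IsUnifInterp {A} S ξ' χ =
  ((a : A) → a ∈ sigₚ χ → S a)
  × Taut (ξ' ⇒ₚ χ)
  × ((ψ : PL A) → ((a : A) → a ∈ sigₚ ψ → a ∈ sigₚ ξ' → S a)
       → Taut (ξ' ⇒ₚ ψ) → Taut (χ ⇒ₚ ψ))

IsStrongestImplicate : List Frame → List ℕ → Fm ℕ → Fm ℕ → Set
IsStrongestImplicate ℱ σ φ χ =
  ((p : ℕ) → p ∈ sig χ → p ∈ σ)
  × InLog ℱ (φ ⇒ₘ χ)
  × ((ψ : Fm ℕ) → ((p : ℕ) → p ∈ sig ψ → p ∈ σ)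
       → InLog ℱ (φ ⇒ₘ ψ) → InLog ℱ (χ ⇒ₘ ψ))

IsEME : List ℕ → List (PL ℕ) → Set
IsEME σ Φ =
  ((i : Fin (length Φ)) (p : ℕ) → p ∈ sigₚ (lookup Φ i) → p ∈ σ)
  × ((i j : Fin (length Φ)) → i ≢ j → (v : ℕ → Bool) →
       evalₚ v (lookup Φ i) ∧ evalₚ v (lookup Φ j) ≡ false)
  × Taut (⋁ₚ Φ)

IsCover : (F : Frame) → (ℕ → W F → Bool) → List ℕ → List (PL ℕ) → Set
IsCover F V σ Φ =
  (i : Fin (length Φ)) (w w' : W F) →
  evalₚ (λ p → V p w) (lookup Φ i) ≡ true →
  evalₚ (λ p → V p w') (lookup Φ i) ≡ true →
  (p : ℕ) → p ∈ σ → V p w ≡ V p w'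

cover : ℕ → List ℕ → List (PL ℕ) → Fm ℕ
cover N σ Φ = ⋀ₘ (concatMap (λ ϕ → map (λ p →
  ◇≤ N (emb ϕ ∧ₘ var p) ⇒ₘ □≤ N (emb ϕ ⇒ₘ var p)) σ) Φ)

-- Abstract Φ-models (k = |Φ|, members of Φ are the atoms Fin k)

record AbsModel (k : ℕ) : Set where
  constructor absModel
  field
    frame : Frame
    f     : W frame → Fin k

absVal : ∀ {k} (F : Frame) → (W F → Fin k) → Fin k → W F → Bool
absVal F f i w = ⌊ f w ≟ i ⌋

AbsSat : ∀ {k} → AbsModel k → Fm (Fin k) → Set
AbsSat (absModel F f) δ = eval F (absVal F f) (root F) δ ≡ true

ForL : ∀ {k} → List Frame → AbsModel k → Set
ForL ℱ M = AbsModel.frame M ∈ ℱ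

IsAbsBisim : ∀ {k} (M M' : AbsModel k) →
  (W (AbsModel.frame M) → W (AbsModel.frame M') → Set) → Set
IsAbsBisim (absModel F f) (absModel G g) Z =
  (∀ w w' → Z w w' → f w ≡ g w')
  × (∀ w w' u → Z w w' → Frame.R F w u ≡ true →
       Σ (W G) λ u' → Frame.R G w' u' ≡ true × Z u u')
  × (∀ w w' u' → Z w w' → Frame.R G w' u' ≡ true →
       Σ (W F) λ u → Frame.R F w u ≡ true × Z u u')

AbsBisimilar : ∀ {k} → AbsModel k → AbsModel k → Set₁
AbsBisimilar M M' =
  Σ (W (AbsModel.frame M) → W (AbsModel.frame M') → Set) λ Z →
    IsAbsBisim M M' Z × Z (root (AbsModel.frame M)) (root (AbsModel.frame M'))

IsClassId : List Frame → (k : ℕ) → Fm (Fin k) → Set₁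
IsClassId ℱ k δ =
  (Σ (AbsModel k) λ M → ForL ℱ M × AbsSat M δ)
  × ((M M' : AbsModel k) → ForL ℱ M → ForL ℱ M' →
       AbsSat M δ → AbsSat M' δ → AbsBisimilar M M')
  × ((M M' : AbsModel k) → ForL ℱ M → ForL ℱ M' →
       AbsSat M δ → AbsBisimilar M M' → AbsSat M' δ)

-- σ-encodings: Γ together with Δ_Φ, as a finite list of pairs (Φ , Δ_Φ)

Encoding : Set
Encoding = List (Σ (List (PL ℕ)) λ Φ → List (Fm (Fin (length Φ))))

δ[_] : (Φ : List (PL ℕ)) → Fm (Fin (length Φ)) → Fm ℕ
δ[ Φ ] = substₘ (λ i → emb (lookup Φ i))

IsEncoding : List Frame → List ℕ → Encoding → Set₁
IsEncoding ℱ σ enc =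
  ((e : Σ (List (PL ℕ)) λ Φ → List (Fm (Fin (length Φ)))) → e ∈ enc →
     IsEME σ (proj₁ e)
     × ((δ : Fm (Fin (length (proj₁ e)))) → δ ∈ proj₂ e →
          IsClassId ℱ (length (proj₁ e)) δ))
  × ((F : Frame) → F ∈ ℱ → (V : ℕ → W F → Bool) →
       Σ (Σ (List (PL ℕ)) λ Φ → List (Fm (Fin (length Φ)))) λ e → e ∈ enc
       × IsCover F V σ (proj₁ e)
       × Σ (Fm (Fin (length (proj₁ e)))) λ δ → δ ∈ proj₂ e
         × eval F V (root F) (δ[ proj₁ e ] δ) ≡ true)

allFuns : (m k : ℕ) → List (Fin m → Fin k)
allFuns zero k = (λ ()) ∷ []
allFuns (suc m) k =
  concatMap (λ i → map (λ g → λ { zero → i ; (suc x) → g x }) (allFuns m k)) (allFin k)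

ξ^ : (N : ℕ) (F : Frame) (Φ : List (PL ℕ)) → (W F → Fin (length Φ)) →
     PL (ℕ × W F) → Fm ℕ
ξ^ N F Φ f = substₚ (λ { (p , w) → ◇≤ N (emb (lookup Φ (f w)) ∧ₘ var p) })

rtClause : (N : ℕ) (σ : List ℕ) (F : Frame) → PL (ℕ × W F) →
  (Φ : List (PL ℕ)) → Fm (Fin (length Φ)) → Fm ℕ
rtClause N σ F ξ Φ δ =
  (cover N σ Φ ∧ₘ δ[ Φ ] δ) ⇒ₘ
  ⋁ₘ (map (λ f → ξ^ N F Φ f ξ)
        (filterᵇ (λ f → eval F (absVal F f) (root F) δ)
                 (allFuns (card F) (length Φ))))

rt : List Frame → List ℕ → Encoding → (F : Frame) → PL (ℕ × W F) → Fm ℕ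
rt ℱ σ enc F ξ =
  ⋀ₘ (concatMap (λ e → map (rtClause (maxSize ℱ) σ F ξ (proj₁ e)) (proj₂ e)) enc)

-- On a rooted frame with at most N+1 worlds every world is reachable from the root in at most N
-- steps, so at the root □^{≤N} and ◇^{≤N} are the universal and existential modalities. Hence
-- cover(σ,Φ) holds at the root exactly when Φ is a σ-cover, and then ◇^{≤N}(ϕ ∧ p) at the root
-- reads off the value of p ∈ σ at any world satisfying ϕ ∈ Φ. For a labelling f of 𝔉, evaluating
-- ξ^f at the root of a model (𝔊,V) amounts to evaluating ξ under the induced valuation
-- p_w ↦ ◇^{≤N}(f(w) ∧ p) on 𝔉.
--   φ → rt: in a model (𝔉,V) of φ take for f the Φ-labelling of the model itself; the induced
-- valuation agrees with V on σ, and tr_{𝔉,0}(φ) → ξ_𝔉.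
--   rt → ψ: if ξ^f holds at the root of (𝔊,V), then (𝔉,f) and the Φ-labelling of (𝔊,V) satisfy
-- the same class identifier δ, so they are abstractly bisimilar, and an abstract bisimulation is
-- a σ-bisimulation between 𝔉 with the induced valuation and (𝔊,V). By uniform interpolation ξ_𝔉
-- entails tr_{𝔉,0}(ψ), so ψ holds in the former model and transfers to (𝔊,V).

module Submission where

open import Defs
open import Data.Nat using (ℕ; zero; suc; _≤_; z≤n)
open import Data.Nat.Properties using (≤-trans; ≤-pred; n≤1+n; m≤m⊔n; m≤n⊔m; m≤n⇒m<n∨m≡n)
open import Data.Fin using (Fin; zero; suc; _≟_)
open import Data.Fin.Properties using (injective⇒≤; any?)
open import Data.Bool using (Bool; true; false; not; _∧_; _∨_)
import Data.Bool.Properties as Bool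
open import Data.List using (List; []; _∷_; map; concatMap; filterᵇ; length; lookup; tabulate; allFin)
open import Data.List.Membership.Propositional using (_∈_; find; lose)
open import Data.List.Membership.Propositional.Properties
  using ( ∈-map⁺; ∈-map⁻; ∈-++⁺ˡ; ∈-++⁺ʳ; ∈-lookup; ∈-allFin; ∈-tabulate⁺
        ; ∈-filter⁺; ∈-filter⁻; ∈-concatMap⁺; ∈-concatMap⁻)
open import Data.List.Relation.Unary.All as All using (All; []; _∷_)
open import Data.List.Relation.Unary.All.Properties using (++⁺; ++⁻ˡ; ++⁻ʳ; ¬Any⇒All¬; map⁺; tabulate⁺)
open import Data.List.Relation.Unary.Any as Any using (Any; here; there; index)
open import Data.List.Relation.Unary.Any.Properties using (lookup-index) renaming (tabulate⁻ to any-tabulate⁻)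
open import Data.List.Relation.Unary.AllPairs using ([]; _∷_)
open import Data.List.Relation.Unary.Unique.Propositional using (Unique)
open import Data.Product using (Σ; ∃; _×_; _,_; proj₁; proj₂; uncurry′)
open import Data.Sum using (_⊎_; inj₁; inj₂)
open import Data.Empty using (⊥-elim)
open import Function using (_∘_)
open import Function.Bundles using (Equivalence)
open import Relation.Binary.PropositionalEquality using (_≡_; _≢_; refl; sym; trans; cong; cong₂; subst; _≗_)
open import Relation.Nullary using (yes; no)
open import Relation.Nullary.Decidable using (⌊_⌋)

open Frame using (R)
open Equivalence using (to; from)

∧-true⁺ : ∀ {x y} → x ≡ true → y ≡ true → x ∧ y ≡ true
∧-true⁺ refl refl = refl

∧-true⁻ : ∀ {x y} → x ∧ y ≡ true → x ≡ true × y ≡ true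
∧-true⁻ {true} {true} _ = refl , refl

not-true⁺ : ∀ {x} → x ≢ true → not x ≡ true
not-true⁺ {false} _ = refl
not-true⁺ {true} x≢true = ⊥-elim (x≢true refl)

not-true⁻ : ∀ {x} → not x ≡ true → x ≢ true
not-true⁻ {false} _ ()

⇒-true⁺ : ∀ {x y} → (x ≡ true → y ≡ true) → not (x ∧ not y) ≡ true
⇒-true⁺ {x} x⇒y = not-true⁺ λ x∧¬y → let x-true , ¬y = ∧-true⁻ {x} x∧¬y in not-true⁻ ¬y (x⇒y x-true)

⇒-true⁻ : ∀ {x y} → not (x ∧ not y) ≡ true → x ≡ true → y ≡ true
⇒-true⁻ {true} {true} _ _ = refl

∨-true⁺ˡ : ∀ {x y} → x ≡ true → not (not x ∧ not y) ≡ true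
∨-true⁺ˡ refl = refl

∨-true⁺ʳ : ∀ {x y} → y ≡ true → not (not x ∧ not y) ≡ true
∨-true⁺ʳ {x} refl = cong not (Bool.∧-zeroʳ (not x))

∨-true⁻ : ∀ {x y} → not (not x ∧ not y) ≡ true → x ≡ true ⊎ y ≡ true
∨-true⁻ {true} _ = inj₁ refl
∨-true⁻ {false} {true} _ = inj₂ refl

bool-ext : ∀ {x y} → (x ≡ true → y ≡ true) → (y ≡ true → x ≡ true) → x ≡ y
bool-ext {true} x⇒y _ = sym (x⇒y refl)
bool-ext {false} {true} _ y⇒x = y⇒x refl
bool-ext {false} {false} _ _ = refl

anyFin-true⁺ : ∀ {k} (g : Fin k → Bool) i → g i ≡ true → anyFin g ≡ true
anyFin-true⁺ g zero gi = cong (_∨ anyFin (g ∘ suc)) gi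
anyFin-true⁺ g (suc i) gi =
  trans (cong (g zero ∨_) (anyFin-true⁺ (g ∘ suc) i gi)) (Bool.∨-zeroʳ (g zero))

anyFin-true⁻ : ∀ {k} (g : Fin k → Bool) → anyFin g ≡ true → ∃ λ i → g i ≡ true
anyFin-true⁻ {suc k} g any-g with g zero in g0
... | true = zero , g0
... | false = let i , gi = anyFin-true⁻ (g ∘ suc) any-g in suc i , gi

anyFin-cong : ∀ {k} {g h : Fin k → Bool} → g ≗ h → anyFin g ≡ anyFin h
anyFin-cong {zero} _ = refl
anyFin-cong {suc k} g≗h = cong₂ _∨_ (g≗h zero) (anyFin-cong (g≗h ∘ suc))

-- Kripke semantics

module _ {A : Set} (F : Frame) (V : A → W F → Bool) where

  ◇-true⁺ : ∀ {w u a} → R F w u ≡ true → eval F V u a ≡ true → eval F V w (◇ a) ≡ true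
  ◇-true⁺ {w} {u} {a} r au = anyFin-true⁺ (λ v → R F w v ∧ eval F V v a) u (∧-true⁺ r au)

  ◇-true⁻ : ∀ {w a} → eval F V w (◇ a) ≡ true → ∃ λ u → R F w u ≡ true × eval F V u a ≡ true
  ◇-true⁻ {w} {a} ◇a =
    let u , r∧a = anyFin-true⁻ (λ v → R F w v ∧ eval F V v a) ◇a in u , ∧-true⁻ r∧a

  □-true⁺ : ∀ {w a} → (∀ u → R F w u ≡ true → eval F V u a ≡ true) → eval F V w (□ a) ≡ true
  □-true⁺ {a = a} all-a = not-true⁺ λ ◇¬a →
    let u , r , ¬a = ◇-true⁻ {a = ¬ₘ a} ◇¬a in not-true⁻ ¬a (all-a u r)

  □-true⁻ : ∀ {w u a} → eval F V w (□ a) ≡ true → R F w u ≡ true → eval F V u a ≡ true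
  □-true⁻ {u = u} {a} □a r with eval F V u a in au
  ... | true = refl
  ... | false = ⊥-elim (not-true⁻ □a (◇-true⁺ {a = ¬ₘ a} r (cong not au)))

  ⋀ₘ-true⁺ : ∀ {w as} → (∀ {a} → a ∈ as → eval F V w a ≡ true) → eval F V w (⋀ₘ as) ≡ true
  ⋀ₘ-true⁺ {as = []} _ = refl
  ⋀ₘ-true⁺ {as = a ∷ as} all-a = ∧-true⁺ (all-a (here refl)) (⋀ₘ-true⁺ (all-a ∘ there))

  ⋀ₘ-true⁻ : ∀ {w as a} → eval F V w (⋀ₘ as) ≡ true → a ∈ as → eval F V w a ≡ true
  ⋀ₘ-true⁻ {as = b ∷ as} ⋀as (here refl) = proj₁ (∧-true⁻ ⋀as)
  ⋀ₘ-true⁻ {w} {b ∷ as} ⋀as (there a∈) = ⋀ₘ-true⁻ (proj₂ (∧-true⁻ {eval F V w b} ⋀as)) a∈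

  ⋁ₘ-true⁺ : ∀ {w as a} → a ∈ as → eval F V w a ≡ true → eval F V w (⋁ₘ as) ≡ true
  ⋁ₘ-true⁺ (here refl) a = ∨-true⁺ˡ a
  ⋁ₘ-true⁺ {w} {b ∷ _} (there a∈) a = ∨-true⁺ʳ {eval F V w b} (⋁ₘ-true⁺ a∈ a)

  ⋁ₘ-true⁻ : ∀ {w as} → eval F V w (⋁ₘ as) ≡ true → Any (λ a → eval F V w a ≡ true) as
  ⋁ₘ-true⁻ {w} {a ∷ as} ⋁as with ∨-true⁻ {eval F V w a} ⋁as
  ... | inj₁ a = here a
  ... | inj₂ ⋁as′ = there (⋁ₘ-true⁻ ⋁as′)

⋁ₚ-true⁺ : ∀ {A : Set} {v : A → Bool} {ϕs ϕ} → ϕ ∈ ϕs → evalₚ v ϕ ≡ true → evalₚ v (⋁ₚ ϕs) ≡ true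
⋁ₚ-true⁺ (here refl) ϕ = ∨-true⁺ˡ ϕ
⋁ₚ-true⁺ {v = v} {ψ ∷ _} (there ϕ∈) ϕ = ∨-true⁺ʳ {evalₚ v ψ} (⋁ₚ-true⁺ ϕ∈ ϕ)

⋁ₚ-true⁻ : ∀ {A : Set} {v : A → Bool} {ϕs} → evalₚ v (⋁ₚ ϕs) ≡ true → Any (λ ϕ → evalₚ v ϕ ≡ true) ϕs
⋁ₚ-true⁻ {v = v} {ϕ ∷ ϕs} ⋁ϕs with ∨-true⁻ {evalₚ v ϕ} ⋁ϕs
... | inj₁ ϕ = here ϕ
... | inj₂ ⋁ϕs′ = there (⋁ₚ-true⁻ ⋁ϕs′)

module _ {A : Set} {P : A → Set} where

  sig-⋀ₘ : ∀ {as} → All (All P ∘ sig) as → All P (sig (⋀ₘ as))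
  sig-⋀ₘ [] = []
  sig-⋀ₘ (a ∷ as) = ++⁺ a (sig-⋀ₘ as)

  sig-⋁ₘ : ∀ {as} → All (All P ∘ sig) as → All P (sig (⋁ₘ as))
  sig-⋁ₘ [] = []
  sig-⋁ₘ (a ∷ as) = ++⁺ a (sig-⋁ₘ as)

  sigₚ-⋁ₚ : ∀ {ϕs} → All (All P ∘ sigₚ) ϕs → All P (sigₚ (⋁ₚ ϕs))
  sigₚ-⋁ₚ [] = []
  sigₚ-⋁ₚ (ϕ ∷ ϕs) = ++⁺ ϕ (sigₚ-⋁ₚ ϕs)

  sig-□^ : ∀ k {a : Fm A} → sig (□^ k a) ≡ sig a
  sig-□^ zero = refl
  sig-□^ (suc k) = sig-□^ k

  sig-□≤ : ∀ N {a : Fm A} → All P (sig a) → All P (sig (□≤ N a))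
  sig-□≤ zero a = a
  sig-□≤ (suc N) {a} a⊆P = ++⁺ (sig-□≤ N a⊆P) (subst (All P) (sym (sig-□^ N {a})) a⊆P)

  sig-substₘ : ∀ {B : Set} {s : B → Fm A} → (∀ b → All P (sig (s b))) → ∀ δ → All P (sig (substₘ s δ))
  sig-substₘ s⊆P (var b) = s⊆P b
  sig-substₘ s⊆P ⊤ₘ = []
  sig-substₘ s⊆P (¬ₘ δ) = sig-substₘ s⊆P δ
  sig-substₘ s⊆P (δ ∧ₘ δ′) = ++⁺ (sig-substₘ s⊆P δ) (sig-substₘ s⊆P δ′)
  sig-substₘ s⊆P (◇ δ) = sig-substₘ s⊆P δ

  sig-substₚ : ∀ {B : Set} {s : B → Fm A} ξ → All (All P ∘ sig ∘ s) (sigₚ ξ) → All P (sig (substₚ s ξ))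
  sig-substₚ (pv b) (s⊆P ∷ []) = s⊆P
  sig-substₚ ⊤ₚ _ = []
  sig-substₚ (¬ₚ ξ) s⊆P = sig-substₚ ξ s⊆P
  sig-substₚ (ξ ∧ₚ ζ) s⊆P = ++⁺ (sig-substₚ ξ (++⁻ˡ (sigₚ ξ) s⊆P)) (sig-substₚ ζ (++⁻ʳ (sigₚ ξ) s⊆P))

  sig-emb : ∀ ϕ → All P (sigₚ ϕ) → All P (sig (emb ϕ))
  sig-emb ϕ ϕ⊆P = sig-substₚ ϕ (All.map (_∷ []) ϕ⊆P)

sig-tr : ∀ {P : ℕ → Set} (F : Frame) w φ → All P (sig φ) → All (P ∘ proj₁) (sigₚ (tr F w φ))
sig-tr F w (var p) (p∈P ∷ []) = p∈P ∷ []
sig-tr F w ⊤ₘ _ = []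
sig-tr F w (¬ₘ φ) φ⊆P = sig-tr F w φ φ⊆P
sig-tr F w (φ ∧ₘ ψ) φψ⊆P = ++⁺ (sig-tr F w φ (++⁻ˡ (sig φ) φψ⊆P)) (sig-tr F w ψ (++⁻ʳ (sig φ) φψ⊆P))
sig-tr F w (◇ φ) φ⊆P =
  sigₚ-⋁ₚ (map⁺ {xs = filterᵇ (R F w) (allFin (card F))} (All.tabulate λ {u} _ → sig-tr F u φ φ⊆P))

-- Substitution and the translation tr

module _ {A : Set} (F : Frame) where

  eval-cong : ∀ {V V′ : A → W F → Bool} → (∀ a w → V a w ≡ V′ a w) → ∀ w φ → eval F V w φ ≡ eval F V′ w φ
  eval-cong V≗V′ w (var a) = V≗V′ a w
  eval-cong V≗V′ w ⊤ₘ = refl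
  eval-cong V≗V′ w (¬ₘ φ) = cong not (eval-cong V≗V′ w φ)
  eval-cong V≗V′ w (φ ∧ₘ ψ) = cong₂ _∧_ (eval-cong V≗V′ w φ) (eval-cong V≗V′ w ψ)
  eval-cong V≗V′ w (◇ φ) = anyFin-cong λ u → cong (R F w u ∧_) (eval-cong V≗V′ u φ)

  eval-substₘ : ∀ {B : Set} (V : A → W F → Bool) (s : B → Fm A) w δ →
    eval F V w (substₘ s δ) ≡ eval F (λ b u → eval F V u (s b)) w δ
  eval-substₘ V s w (var b) = refl
  eval-substₘ V s w ⊤ₘ = refl
  eval-substₘ V s w (¬ₘ δ) = cong not (eval-substₘ V s w δ)
  eval-substₘ V s w (δ ∧ₘ δ′) = cong₂ _∧_ (eval-substₘ V s w δ) (eval-substₘ V s w δ′)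
  eval-substₘ V s w (◇ δ) = anyFin-cong λ u → cong (R F w u ∧_) (eval-substₘ V s u δ)

  eval-substₚ : ∀ {B : Set} (V : A → W F → Bool) (s : B → Fm A) w ξ →
    eval F V w (substₚ s ξ) ≡ evalₚ (λ b → eval F V w (s b)) ξ
  eval-substₚ V s w (pv b) = refl
  eval-substₚ V s w ⊤ₚ = refl
  eval-substₚ V s w (¬ₚ ξ) = cong not (eval-substₚ V s w ξ)
  eval-substₚ V s w (ξ ∧ₚ ζ) = cong₂ _∧_ (eval-substₚ V s w ξ) (eval-substₚ V s w ζ)

  eval-emb : ∀ (V : A → W F → Bool) w ϕ → eval F V w (emb ϕ) ≡ evalₚ (λ a → V a w) ϕ
  eval-emb V w = eval-substₚ V var w

evalₚ-cong : ∀ {A : Set} {u v : A → Bool} ξ → (∀ {a} → a ∈ sigₚ ξ → u a ≡ v a) → evalₚ u ξ ≡ evalₚ v ξ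
evalₚ-cong (pv a) u≗v = u≗v (here refl)
evalₚ-cong ⊤ₚ _ = refl
evalₚ-cong (¬ₚ ξ) u≗v = cong not (evalₚ-cong ξ u≗v)
evalₚ-cong (ξ ∧ₚ ζ) u≗v = cong₂ _∧_ (evalₚ-cong ξ (u≗v ∘ ∈-++⁺ˡ)) (evalₚ-cong ζ (u≗v ∘ ∈-++⁺ʳ (sigₚ ξ)))

eval-tr : ∀ (F : Frame) (v : ℕ × W F → Bool) w φ → evalₚ v (tr F w φ) ≡ eval F (λ p u → v (p , u)) w φ
eval-tr F v w (var p) = refl
eval-tr F v w ⊤ₘ = refl
eval-tr F v w (¬ₘ φ) = cong not (eval-tr F v w φ)
eval-tr F v w (φ ∧ₘ ψ) = cong₂ _∧_ (eval-tr F v w φ) (eval-tr F v w ψ)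
eval-tr F v w (◇ φ) = bool-ext to◇ from◇
  where
  V : ℕ → W F → Bool
  V p u = v (p , u)
  trs : List (PL (ℕ × W F))
  trs = map (λ u → tr F u φ) (filterᵇ (R F w) (allFin (card F)))

  to◇ : evalₚ v (tr F w (◇ φ)) ≡ true → eval F V w (◇ φ) ≡ true
  to◇ ⋁tr with find (⋁ₚ-true⁻ {ϕs = trs} ⋁tr)
  ... | _ , tr∈ , trφ with ∈-map⁻ (λ u → tr F u φ) tr∈
  ... | u , u∈ , refl =
    ◇-true⁺ F V {a = φ} (to Bool.T-≡ (proj₂ (∈-filter⁻ (Bool.T? ∘ R F w) u∈)))
                        (trans (sym (eval-tr F v u φ)) trφ)

  from◇ : eval F V w (◇ φ) ≡ true → evalₚ v (tr F w (◇ φ)) ≡ true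
  from◇ ◇φ =
    let u , r , φu = ◇-true⁻ F V {a = φ} ◇φ
    in ⋁ₚ-true⁺ (∈-map⁺ (λ u → tr F u φ) (∈-filter⁺ (Bool.T? ∘ R F w) (∈-allFin u) (from Bool.T-≡ r)))
                (trans (eval-tr F v u φ) φu)

-- Bounded modalities on rooted finite frames

lookup-injective : ∀ {A : Set} {xs : List A} → Unique xs → ∀ {i j} → lookup xs i ≡ lookup xs j → i ≡ j
lookup-injective (_ ∷ _) {zero} {zero} _ = refl
lookup-injective (x≢ ∷ _) {zero} {suc j} x≡ = ⊥-elim (All.lookup x≢ (∈-lookup j) x≡)
lookup-injective (x≢ ∷ _) {suc i} {zero} ≡x = ⊥-elim (All.lookup x≢ (∈-lookup i) (sym ≡x))
lookup-injective (_ ∷ xs!) {suc i} {suc j} eq = cong suc (lookup-injective xs! eq)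

Unique⇒length≤ : ∀ {k} {xs : List (Fin k)} → Unique xs → length xs ≤ k
Unique⇒length≤ xs! = injective⇒≤ (lookup-injective xs!)

module _ {F : Frame} where

  steps : ∀ {x w} → Reach F x w → ℕ
  steps here = zero
  steps (step _ p) = suc (steps p)

  vertices : ∀ {x w} → Reach F x w → List (W F)
  vertices {w = w} here = w ∷ []
  vertices {x = x} (step _ p) = x ∷ vertices p

  length-vertices : ∀ {x w} (p : Reach F x w) → length (vertices p) ≡ suc (steps p)
  length-vertices here = refl
  length-vertices (step _ p) = cong suc (length-vertices p)

  SimplePath : W F → W F → Set
  SimplePath x w = Σ (Reach F x w) (Unique ∘ vertices)

  suffix : ∀ {x y w} (p : Reach F x w) → Unique (vertices p) → y ∈ vertices p → SimplePath y w
  suffix here p! (here refl) = here , p!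
  suffix (step r p) p! (here refl) = step r p , p!
  suffix (step r p) (_ ∷ p!) (there y∈) = suffix p p! y∈

  simplePath : ∀ {x w} → Reach F x w → SimplePath x w
  simplePath here = here , [] ∷ []
  simplePath {x} (step r p) with simplePath p
  ... | q , q! with Any.any? (x ≟_) (vertices q)
  ... | yes x∈ = suffix q q! x∈
  ... | no x∉ = step r q , ¬Any⇒All¬ (vertices q) x∉ ∷ q!

  shortPath : ∀ {x w} → Reach F x w → Σ (Reach F x w) λ p → steps p ≤ Frame.n F
  shortPath r =
    let p , p! = simplePath r
    in p , ≤-pred (subst (_≤ card F) (length-vertices p) (Unique⇒length≤ p!))

module _ {A : Set} (F : Frame) (V : A → W F → Bool) where

  □^-steps : ∀ {x w a} (p : Reach F x w) → eval F V x (□^ (steps p) a) ≡ true → eval F V w a ≡ true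
  □^-steps here a = a
  □^-steps {a = a} (step r p) □a = □^-steps p (□-true⁻ F V {a = □^ (steps p) a} □a r)

  □≤⇒□^ : ∀ {N k x a} → k ≤ N → eval F V x (□≤ N a) ≡ true → eval F V x (□^ k a) ≡ true
  □≤⇒□^ {zero} z≤n □a = □a
  □≤⇒□^ {suc N} {x = x} {a} k≤ □≤a with m≤n⇒m<n∨m≡n k≤
  ... | inj₁ k< = □≤⇒□^ (≤-pred k<) (proj₁ (∧-true⁻ {eval F V x (□≤ N a)} □≤a))
  ... | inj₂ refl = proj₂ (∧-true⁻ {eval F V x (□≤ N a)} □≤a)

  □^-valid : ∀ {a} → (∀ u → eval F V u a ≡ true) → ∀ k x → eval F V x (□^ k a) ≡ true
  □^-valid a-valid zero x = a-valid x
  □^-valid {a} a-valid (suc k) x = □-true⁺ F V {a = □^ k a} λ u _ → □^-valid a-valid k u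

  □≤-valid : ∀ {a} → (∀ u → eval F V u a ≡ true) → ∀ N x → eval F V x (□≤ N a) ≡ true
  □≤-valid a-valid zero x = a-valid x
  □≤-valid a-valid (suc N) x = ∧-true⁺ (□≤-valid a-valid N x) (□^-valid a-valid (suc N) x)

  ◇≤-true⁻ : ∀ {N x a} → eval F V x (◇≤ N a) ≡ true → ∃ λ w → eval F V w a ≡ true
  ◇≤-true⁻ {N} {x} {a} ◇≤a with any? (λ w → eval F V w a Bool.≟ true)
  ... | yes found = found
  ... | no none = ⊥-elim (not-true⁻ ◇≤a (□≤-valid (λ u → not-true⁺ λ au → none (u , au)) N x))

  module _ (rooted : Rooted F) {N} (n≤N : Frame.n F ≤ N) where

    □≤-root⁻ : ∀ {a} → eval F V (root F) (□≤ N a) ≡ true → ∀ w → eval F V w a ≡ true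
    □≤-root⁻ □≤a w =
      let p , p≤n = shortPath (rooted w) in □^-steps p (□≤⇒□^ (≤-trans p≤n n≤N) □≤a)

    ◇≤-root⁺ : ∀ {w a} → eval F V w a ≡ true → eval F V (root F) (◇≤ N a) ≡ true
    ◇≤-root⁺ {w} {a} aw = not-true⁺ λ □≤¬a → not-true⁻ (□≤-root⁻ {¬ₘ a} □≤¬a w) aw

-- EMEs and covers

module _ {σ : List ℕ} {Φ : List (PL ℕ)} (eme : IsEME σ Φ) where

  private
    satisfied : (v : ℕ → Bool) → Any (λ ϕ → evalₚ v ϕ ≡ true) Φ
    satisfied v = ⋁ₚ-true⁻ (proj₂ (proj₂ eme) v)

  memberAt : (ℕ → Bool) → Fin (length Φ)
  memberAt v = index (satisfied v)

  memberAt-true : ∀ v → evalₚ v (lookup Φ (memberAt v)) ≡ true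
  memberAt-true v = lookup-index (satisfied v)

  evalₚ-member : ∀ v i → evalₚ v (lookup Φ i) ≡ ⌊ memberAt v ≟ i ⌋
  evalₚ-member v i with memberAt v ≟ i
  ... | yes refl = memberAt-true v
  ... | no j≢i =
    subst (λ b → b ∧ evalₚ v (lookup Φ i) ≡ false) (memberAt-true v) (proj₁ (proj₂ eme) _ i j≢i v)

  member-sig : ∀ {ϕ} → ϕ ∈ Φ → All (_∈ σ) (sigₚ ϕ)
  member-sig ϕ∈ = subst (All (_∈ σ) ∘ sigₚ) (sym (lookup-index ϕ∈)) (All.tabulate (proj₁ eme (index ϕ∈) _))

  labelling : (F : Frame) → (ℕ → W F → Bool) → W F → Fin (length Φ)
  labelling F V w = memberAt (λ p → V p w)

  eval-δ[] : ∀ F V w δ → eval F V w (δ[ Φ ] δ) ≡ eval F (absVal F (labelling F V)) w δ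
  eval-δ[] F V w δ = trans (eval-substₘ F V _ w δ)
    (eval-cong F (λ i u → trans (eval-emb F V u (lookup Φ i)) (evalₚ-member _ i)) w δ)

module _ {X Z : Set} {Y : X → Set} (c : (x : X) → Y x → Z) (ys : (x : X) → List (Y x)) where

  ∈-grid⁺ : ∀ {xs x y} → x ∈ xs → y ∈ ys x → c x y ∈ concatMap (λ x → map (c x) (ys x)) xs
  ∈-grid⁺ x∈ y∈ = ∈-concatMap⁺ (λ x → map (c x) (ys x)) (lose x∈ (∈-map⁺ (c _) y∈))

  ∈-grid⁻ : ∀ {xs z} → z ∈ concatMap (λ x → map (c x) (ys x)) xs →
    ∃ λ x → x ∈ xs × ∃ λ y → y ∈ ys x × z ≡ c x y
  ∈-grid⁻ z∈ with find (∈-concatMap⁻ (λ x → map (c x) (ys x)) z∈)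
  ... | x , x∈ , z∈cx with ∈-map⁻ (c x) z∈cx
  ... | y , y∈ , z≡ = x , x∈ , y , y∈ , z≡

probe : ℕ → PL ℕ → ℕ → Fm ℕ
probe N ϕ p = ◇≤ N (emb ϕ ∧ₘ var p)

coverAxiom : ℕ → PL ℕ → ℕ → Fm ℕ
coverAxiom N ϕ p = probe N ϕ p ⇒ₘ □≤ N (emb ϕ ⇒ₘ var p)

sig-probe : ∀ {P : ℕ → Set} N ϕ {p} → All P (sigₚ ϕ) → P p → All P (sig (probe N ϕ p))
sig-probe N ϕ ϕ⊆P p∈P = sig-□≤ N (++⁺ (sig-emb ϕ ϕ⊆P) (p∈P ∷ []))

sig-coverAxiom : ∀ {P : ℕ → Set} N ϕ {p} → All P (sigₚ ϕ) → P p → All P (sig (coverAxiom N ϕ p))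
sig-coverAxiom N ϕ ϕ⊆P p∈P = ++⁺ (sig-probe N ϕ ϕ⊆P p∈P) (sig-□≤ N (++⁺ (sig-emb ϕ ϕ⊆P) (p∈P ∷ [])))

module _ {σ : List ℕ} {Φ : List (PL ℕ)} {N : ℕ} (F : Frame) (V : ℕ → W F → Bool) where

  private
    emb-true : ∀ {w} ϕ → evalₚ (λ q → V q w) ϕ ≡ true → eval F V w (emb ϕ) ≡ true
    emb-true {w} ϕ = trans (eval-emb F V w ϕ)

    emb-true⁻ : ∀ {w} ϕ → eval F V w (emb ϕ) ≡ true → evalₚ (λ q → V q w) ϕ ≡ true
    emb-true⁻ {w} ϕ = trans (sym (eval-emb F V w ϕ))

  cover-true⁺ : ∀ {w} → (∀ i {p} → p ∈ σ → eval F V w (coverAxiom N (lookup Φ i) p) ≡ true) →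
    eval F V w (cover N σ Φ) ≡ true
  cover-true⁺ {w} axioms = ⋀ₘ-true⁺ F V axiom
    where
    axiom : ∀ {a} → a ∈ concatMap (λ ϕ → map (coverAxiom N ϕ) σ) Φ → eval F V w a ≡ true
    axiom a∈ with ∈-grid⁻ (coverAxiom N) (λ _ → σ) {Φ} a∈
    ... | ϕ , ϕ∈ , p , p∈ , refl =
      subst (λ ϕ → eval F V w (coverAxiom N ϕ p) ≡ true) (sym (lookup-index ϕ∈)) (axioms (index ϕ∈) p∈)

  cover-true⁻ : ∀ {w} → eval F V w (cover N σ Φ) ≡ true →
    ∀ i {p} → p ∈ σ → eval F V w (coverAxiom N (lookup Φ i) p) ≡ true
  cover-true⁻ cov i p∈ = ⋀ₘ-true⁻ F V cov (∈-grid⁺ (coverAxiom N) (λ _ → σ) (∈-lookup {xs = Φ} i) p∈)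

  probe-true⁻ : IsCover F V σ Φ → ∀ {x u i p} → p ∈ σ → eval F V x (probe N (lookup Φ i) p) ≡ true →
    evalₚ (λ q → V q u) (lookup Φ i) ≡ true → V p u ≡ true
  probe-true⁻ isCover {x} {u} {i} {p} p∈ probe-x ϕu =
    let y , ϕ∧p = ◇≤-true⁻ F V {N} {x} {emb (lookup Φ i) ∧ₘ var p} probe-x
        ϕy , py = ∧-true⁻ {eval F V y (emb (lookup Φ i))} ϕ∧p
    in trans (sym (isCover i y u (emb-true⁻ (lookup Φ i) ϕy) ϕu p p∈)) py

  cover-complete : IsCover F V σ Φ → ∀ w → eval F V w (cover N σ Φ) ≡ true
  cover-complete isCover w = cover-true⁺ λ i {p} p∈ →
    ⇒-true⁺ {eval F V w (probe N (lookup Φ i) p)} λ probe-w →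
      □≤-valid F V (λ u → ⇒-true⁺ {eval F V u (emb (lookup Φ i))} λ ϕu →
        probe-true⁻ isCover p∈ probe-w (emb-true⁻ (lookup Φ i) ϕu)) N w

  module _ (rooted : Rooted F) (n≤N : Frame.n F ≤ N) where

    cover-sound : eval F V (root F) (cover N σ Φ) ≡ true → IsCover F V σ Φ
    cover-sound cov i w w′ ϕw ϕw′ p p∈ = bool-ext (transfer ϕw ϕw′) (transfer ϕw′ ϕw)
      where
      ϕ : PL ℕ
      ϕ = lookup Φ i
      transfer : ∀ {x y} → evalₚ (λ q → V q x) ϕ ≡ true → evalₚ (λ q → V q y) ϕ ≡ true →
        V p x ≡ true → V p y ≡ true
      transfer {x} {y} ϕx ϕy px =
        let probe-root = ◇≤-root⁺ F V rooted n≤N {x} {emb ϕ ∧ₘ var p} (∧-true⁺ (emb-true ϕ ϕx) px)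
            box-root = ⇒-true⁻ {eval F V (root F) (probe N ϕ p)} (cover-true⁻ cov i p∈) probe-root
        in ⇒-true⁻ {eval F V y (emb ϕ)} (□≤-root⁻ F V rooted n≤N {emb ϕ ⇒ₘ var p} box-root y) (emb-true ϕ ϕy)

    eval-probe : IsCover F V σ Φ → ∀ {w i p} → evalₚ (λ q → V q w) (lookup Φ i) ≡ true → p ∈ σ →
      eval F V (root F) (probe N (lookup Φ i) p) ≡ V p w
    eval-probe isCover {w} {i} {p} ϕw p∈ = bool-ext
      (λ probe-root → probe-true⁻ isCover p∈ probe-root ϕw)
      (λ pw → ◇≤-root⁺ F V rooted n≤N {w} {emb (lookup Φ i) ∧ₘ var p} (∧-true⁺ (emb-true (lookup Φ i) ϕw) pw))

-- Bisimulations

record IsBisimulation {A : Set} (P : A → Set) (F : Frame) (V : A → W F → Bool)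
                      (G : Frame) (V′ : A → W G → Bool) (Z : W F → W G → Set) : Set where
  field
    atoms : ∀ {w w′} → Z w w′ → ∀ {a} → P a → V a w ≡ V′ a w′
    forth : ∀ {w w′ u} → Z w w′ → R F w u ≡ true → ∃ λ u′ → R G w′ u′ ≡ true × Z u u′
    back  : ∀ {w w′ u′} → Z w w′ → R G w′ u′ ≡ true → ∃ λ u → R F w u ≡ true × Z u u′

module _ {A : Set} {P : A → Set} {F G : Frame} {V : A → W F → Bool} {V′ : A → W G → Bool}
         {Z : W F → W G → Set} (bisim : IsBisimulation P F V G V′ Z) where

  open IsBisimulation bisim

  bisim-invariant : ∀ φ → All P (sig φ) → ∀ {w w′} → Z w w′ → eval F V w φ ≡ eval G V′ w′ φ
  bisim-invariant (var a) (a∈P ∷ []) z = atoms z a∈P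
  bisim-invariant ⊤ₘ _ z = refl
  bisim-invariant (¬ₘ φ) φ⊆P z = cong not (bisim-invariant φ φ⊆P z)
  bisim-invariant (φ ∧ₘ ψ) φψ⊆P z =
    cong₂ _∧_ (bisim-invariant φ (++⁻ˡ (sig φ) φψ⊆P) z) (bisim-invariant ψ (++⁻ʳ (sig φ) φψ⊆P) z)
  bisim-invariant (◇ φ) φ⊆P {w} {w′} z = bool-ext to◇ from◇
    where
    to◇ : eval F V w (◇ φ) ≡ true → eval G V′ w′ (◇ φ) ≡ true
    to◇ ◇φ = let u , r , φu = ◇-true⁻ F V {a = φ} ◇φ
                 u′ , r′ , z′ = forth z r
             in ◇-true⁺ G V′ {a = φ} r′ (trans (sym (bisim-invariant φ φ⊆P z′)) φu)

    from◇ : eval G V′ w′ (◇ φ) ≡ true → eval F V w (◇ φ) ≡ true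
    from◇ ◇φ = let u′ , r′ , φu′ = ◇-true⁻ G V′ {a = φ} ◇φ
                   u , r , z′ = back z r′
               in ◇-true⁺ F V {a = φ} r (trans (bisim-invariant φ φ⊆P z′) φu′)

IsAbsBisim⇒IsBisimulation : ∀ {k} {F G : Frame} {f : W F → Fin k} {g : W G → Fin k} {Z}
  {A : Set} {P : A → Set} {V : A → W F → Bool} {V′ : A → W G → Bool} →
  IsAbsBisim (absModel F f) (absModel G g) Z →
  (∀ {w w′} → f w ≡ g w′ → ∀ {a} → P a → V a w ≡ V′ a w′) → IsBisimulation P F V G V′ Z
IsAbsBisim⇒IsBisimulation (f≡g , forth , back) agree = record
  { atoms = λ z → agree (f≡g _ _ z)
  ; forth = λ z → forth _ _ _ z
  ; back  = λ z → back _ _ _ z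
  }

-- The formula rt

-- Only up to ≗: without function extensionality f itself need not occur in the list.
allFuns-complete : ∀ m k (f : Fin m → Fin k) → ∃ λ f′ → f′ ∈ allFuns m k × f′ ≗ f
allFuns-complete zero k f = _ , here refl , λ ()
allFuns-complete (suc m) k f =
  let g , g∈ , g≗f = allFuns-complete m k (f ∘ suc)
  in _ , ∈-concatMap⁺ _ (lose (∈-allFin (f zero)) (∈-map⁺ _ g∈)) , λ { zero → refl ; (suc x) → g≗f x }

-- The members of [δ]_L based on F, as labellings.
classOn : (F : Frame) {k : ℕ} → Fm (Fin k) → List (W F → Fin k)
classOn F {k} δ = filterᵇ (λ f → eval F (absVal F f) (root F) δ) (allFuns (card F) k)

∈-classOn⁺ : ∀ {F k} {δ : Fm (Fin k)} {f} → AbsSat (absModel F f) δ → ∃ λ f′ → f′ ∈ classOn F δ × f′ ≗ f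
∈-classOn⁺ {F} {k} {δ} {f} f⊨δ =
  let f′ , f′∈ , f′≗f = allFuns-complete (card F) k f
      f′⊨δ = trans (eval-cong F (λ i w → cong (λ j → ⌊ j ≟ i ⌋) (f′≗f w)) (root F) δ) f⊨δ
  in f′ , ∈-filter⁺ (Bool.T? ∘ λ f → eval F (absVal F f) (root F) δ) f′∈ (from Bool.T-≡ f′⊨δ) , f′≗f

∈-classOn⁻ : ∀ {F k} {δ : Fm (Fin k)} {f} → f ∈ classOn F δ → AbsSat (absModel F f) δ
∈-classOn⁻ {F} {k} {δ} f∈ =
  to Bool.T-≡ (proj₂ (∈-filter⁻ (Bool.T? ∘ λ f → eval F (absVal F f) (root F) δ)
                                {xs = allFuns (card F) k} f∈))

inducedVal : ℕ → (G : Frame) → (ℕ → W G → Bool) → (Φ : List (PL ℕ)) (F : Frame) →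
  (W F → Fin (length Φ)) → ℕ → W F → Bool
inducedVal N G V Φ F f p w = eval G V (root G) (probe N (lookup Φ (f w)) p)

eval-ξ^ : ∀ N G V Φ F (f : W F → Fin (length Φ)) ξ →
  eval G V (root G) (ξ^ N F Φ f ξ) ≡ evalₚ (uncurry′ (inducedVal N G V Φ F f)) ξ
eval-ξ^ N G V Φ F f ξ = eval-substₚ G V (λ a → probe N (lookup Φ (f (proj₂ a))) (proj₁ a)) (root G) ξ

module _ {N : ℕ} {σ : List ℕ} {Φ : List (PL ℕ)} (eme : IsEME σ Φ) (G : Frame) (V : ℕ → W G → Bool)
         (rooted : Rooted G) (n≤N : Frame.n G ≤ N) (isCover : IsCover G V σ Φ) where

  inducedVal-labelling : ∀ {p} → p ∈ σ → ∀ w → inducedVal N G V Φ G (labelling {Φ = Φ} eme G V) p w ≡ V p w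
  inducedVal-labelling p∈ w = eval-probe {Φ = Φ} G V rooted n≤N isCover (memberAt-true {Φ = Φ} eme _) p∈

  inducedVal-bisim : ∀ {F f Z} → IsAbsBisim (absModel F f) (absModel G (labelling {Φ = Φ} eme G V)) Z →
    IsBisimulation (_∈ σ) F (inducedVal N G V Φ F f) G V Z
  inducedVal-bisim absBisim = IsAbsBisim⇒IsBisimulation absBisim λ {w} {w′} fw≡ℓw′ {p} p∈ →
    trans (cong (λ j → eval G V (root G) (probe N (lookup Φ j) p)) fw≡ℓw′) (inducedVal-labelling p∈ w′)

module _ {N : ℕ} {σ : List ℕ} {F : Frame} {ξ : PL (ℕ × W F)} {Φ : List (PL ℕ)} {δ : Fm (Fin (length Φ))} where

  ⋁ξ^-true⁺ : ∀ {G V f} → AbsSat (absModel F f) δ → evalₚ (uncurry′ (inducedVal N G V Φ F f)) ξ ≡ true →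
    eval G V (root G) (⋁ₘ (map (λ f → ξ^ N F Φ f ξ) (classOn F δ))) ≡ true
  ⋁ξ^-true⁺ {G} {V} {f} f⊨δ ξ-true =
    let f′ , f′∈ , f′≗f = ∈-classOn⁺ {F} {δ = δ} f⊨δ
        induced≗ : ∀ {a} → a ∈ sigₚ ξ →
          uncurry′ (inducedVal N G V Φ F f′) a ≡ uncurry′ (inducedVal N G V Φ F f) a
        induced≗ {p , w} _ = cong (λ j → eval G V (root G) (probe N (lookup Φ j) p)) (f′≗f w)
    in ⋁ₘ-true⁺ G V (∈-map⁺ (λ f → ξ^ N F Φ f ξ) f′∈)
         (trans (eval-ξ^ N G V Φ F f′ ξ) (trans (evalₚ-cong ξ induced≗) ξ-true))

  ⋁ξ^-true⁻ : ∀ {G V} → eval G V (root G) (⋁ₘ (map (λ f → ξ^ N F Φ f ξ) (classOn F δ))) ≡ true →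
    ∃ λ f → AbsSat (absModel F f) δ × evalₚ (uncurry′ (inducedVal N G V Φ F f)) ξ ≡ true
  ⋁ξ^-true⁻ {G} {V} ⋁ξ^ with find (⋁ₘ-true⁻ G V {as = map (λ f → ξ^ N F Φ f ξ) (classOn F δ)} ⋁ξ^)
  ... | _ , ξ^∈ , ξ^-true with ∈-map⁻ (λ f → ξ^ N F Φ f ξ) ξ^∈
  ... | f , f∈ , refl = f , ∈-classOn⁻ {F} {δ = δ} f∈ , trans (sym (eval-ξ^ N G V Φ F f ξ)) ξ^-true

  sig-rtClause : IsEME σ Φ → All (σ_ σ F) (sigₚ ξ) → All (_∈ σ) (sig (rtClause N σ F ξ Φ δ))
  sig-rtClause eme ξ⊆σ =
    ++⁺ (++⁺ sig-cover sig-δ) (sig-⋁ₘ (map⁺ {xs = classOn F δ} (All.tabulate λ {f} _ → sig-ξ^ f)))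
    where
    sig-cover : All (_∈ σ) (sig (cover N σ Φ))
    sig-cover = sig-⋀ₘ (All.tabulate axiom-sig)
      where
      axiom-sig : ∀ {a} → a ∈ concatMap (λ ϕ → map (coverAxiom N ϕ) σ) Φ → All (_∈ σ) (sig a)
      axiom-sig a∈ with ∈-grid⁻ (coverAxiom N) (λ _ → σ) {Φ} a∈
      ... | ϕ , ϕ∈ , p , p∈ , refl = sig-coverAxiom N ϕ (member-sig {Φ = Φ} eme ϕ∈) p∈

    sig-δ : All (_∈ σ) (sig (δ[ Φ ] δ))
    sig-δ = sig-substₘ (λ i → sig-emb (lookup Φ i) (member-sig {Φ = Φ} eme (∈-lookup i))) δ

    sig-ξ^ : ∀ f → All (_∈ σ) (sig (ξ^ N F Φ f ξ))
    sig-ξ^ f = sig-substₚ ξ (All.map (λ {a} p∈ →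
      sig-probe N (lookup Φ (f (proj₂ a))) (member-sig {Φ = Φ} eme (∈-lookup (f (proj₂ a)))) p∈) ξ⊆σ)

  rtClause-true : IsEME σ Φ → Rooted F → Frame.n F ≤ N → All (σ_ σ F) (sigₚ ξ) →
    ∀ {V} → evalₚ (uncurry′ V) ξ ≡ true → eval F V (root F) (rtClause N σ F ξ Φ δ) ≡ true
  rtClause-true eme rooted n≤N ξ⊆σ {V} ξ-true =
    ⇒-true⁺ {eval F V (root F) (cover N σ Φ ∧ₘ δ[ Φ ] δ)} λ premise →
      let cov , δ-true = ∧-true⁻ {eval F V (root F) (cover N σ Φ)} premise
          isCover = cover-sound {Φ = Φ} F V rooted n≤N cov
          induced≗V : ∀ {a} → a ∈ sigₚ ξ →
            uncurry′ (inducedVal N F V Φ F (labelling {Φ = Φ} eme F V)) a ≡ uncurry′ V a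
          induced≗V {p , w} a∈ = inducedVal-labelling {Φ = Φ} eme F V rooted n≤N isCover (All.lookup ξ⊆σ a∈) w
      in ⋁ξ^-true⁺ (trans (sym (eval-δ[] {Φ = Φ} eme F V (root F) δ)) δ-true)
                   (trans (evalₚ-cong ξ induced≗V) ξ-true)

  rtClause-true⁻ : ∀ {G V} → eval G V (root G) (rtClause N σ F ξ Φ δ) ≡ true → IsCover G V σ Φ →
    eval G V (root G) (δ[ Φ ] δ) ≡ true →
    ∃ λ f → AbsSat (absModel F f) δ × evalₚ (uncurry′ (inducedVal N G V Φ F f)) ξ ≡ true
  rtClause-true⁻ {G} {V} clause isCover δ-true = ⋁ξ^-true⁻
    (⇒-true⁻ {eval G V (root G) (cover N σ Φ ∧ₘ δ[ Φ ] δ)} clause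
      (∧-true⁺ (cover-complete {Φ = Φ} {N} G V isCover (root G)) δ-true))

n≤maxSize : ∀ {ℱ F} → F ∈ ℱ → Frame.n F ≤ maxSize ℱ
n≤maxSize {G ∷ ℱ} (here refl) = ≤-trans (n≤1+n _) (m≤m⊔n (card G) (maxSize ℱ))
n≤maxSize {G ∷ ℱ} (there F∈) = ≤-trans (n≤maxSize F∈) (m≤n⊔m (card G) (maxSize ℱ))

InLog⇒Taut-tr : ∀ {ℱ F φ ψ} → InLog ℱ (φ ⇒ₘ ψ) → F ∈ ℱ → Taut (tr F (root F) φ ⇒ₚ tr F (root F) ψ)
InLog⇒Taut-tr {F = F} {φ} {ψ} φ⇒ψ F∈ v =
  trans (cong₂ (λ a b → not (a ∧ not b)) (eval-tr F v (root F) φ) (eval-tr F v (root F) ψ))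
        (φ⇒ψ F F∈ (λ p u → v (p , u)))

module _ {ℱ : List Frame} {σ : List ℕ} {enc : Encoding} (isEnc : IsEncoding ℱ σ enc)
         {F : Frame} {ξ : PL (ℕ × W F)} where

  private
    N : ℕ
    N = maxSize ℱ

    clause : (e : Σ (List (PL ℕ)) λ Φ → List (Fm (Fin (length Φ)))) → Fm (Fin (length (proj₁ e))) → Fm ℕ
    clause e = rtClause N σ F ξ (proj₁ e)

    eme : ∀ {e} → e ∈ enc → IsEME σ (proj₁ e)
    eme e∈ = proj₁ (proj₁ isEnc _ e∈)

  rt-sig : All (σ_ σ F) (sigₚ ξ) → All (_∈ σ) (sig (rt ℱ σ enc F ξ))
  rt-sig ξ⊆σ = sig-⋀ₘ (All.tabulate clause-sig)
    where
    clause-sig : ∀ {c} → c ∈ concatMap (λ e → map (clause e) (proj₂ e)) enc → All (_∈ σ) (sig c)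
    clause-sig c∈ with ∈-grid⁻ clause proj₂ {enc} c∈
    ... | e , e∈ , δ , _ , refl = sig-rtClause {N} {σ} {F} {ξ} {proj₁ e} {δ} (eme e∈) ξ⊆σ

  rt-true : F ∈ ℱ → Rooted F → All (σ_ σ F) (sigₚ ξ) →
    ∀ {V} → evalₚ (uncurry′ V) ξ ≡ true → eval F V (root F) (rt ℱ σ enc F ξ) ≡ true
  rt-true F∈ rooted ξ⊆σ {V} ξ-true = ⋀ₘ-true⁺ F V clause-true
    where
    clause-true : ∀ {c} → c ∈ concatMap (λ e → map (clause e) (proj₂ e)) enc → eval F V (root F) c ≡ true
    clause-true c∈ with ∈-grid⁻ clause proj₂ {enc} c∈
    ... | e , e∈ , δ , _ , refl =
      rtClause-true {N} {σ} {F} {ξ} {proj₁ e} {δ} (eme e∈) rooted (n≤maxSize F∈) ξ⊆σ ξ-true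

  rt-reflect : F ∈ ℱ → ∀ {G} → G ∈ ℱ → Rooted G → ∀ V → eval G V (root G) (rt ℱ σ enc F ξ) ≡ true →
    ∃ λ V′ → evalₚ (uncurry′ V′) ξ ≡ true ×
             (∀ ψ → All (_∈ σ) (sig ψ) → eval F V′ (root F) ψ ≡ eval G V (root G) ψ)
  rt-reflect F∈ {G} G∈ rooted V rt-holds with proj₂ isEnc G G∈ V
  ... | e@(Φ , _) , e∈ , isCover , δ , δ∈ , δ-true
      with rtClause-true⁻ {N} {σ} {F} {ξ} {Φ} {δ}
             (⋀ₘ-true⁻ G V rt-holds (∈-grid⁺ clause proj₂ e∈ δ∈)) isCover δ-true
  ... | f , f⊨δ , ξ-true
      with proj₁ (proj₂ (proj₂ (proj₁ isEnc e e∈) δ δ∈))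
             (absModel F f) (absModel G (labelling {Φ = Φ} (eme e∈) G V)) F∈ G∈ f⊨δ
             (trans (sym (eval-δ[] {Φ = Φ} (eme e∈) G V (root G) δ)) δ-true)
  ... | Z , absBisim , z₀ =
    inducedVal N G V Φ F f , ξ-true , λ ψ ψ⊆σ →
      bisim-invariant (inducedVal-bisim {Φ = Φ} (eme e∈) G V rooted (n≤maxSize G∈) isCover absBisim) ψ ψ⊆σ z₀

  module _ {φ : Fm ℕ} (interp : IsUnifInterp (σ_ σ F) (tr F (root F) φ) ξ) (F∈ : F ∈ ℱ) where

    rt-implied : Rooted F → ∀ V → eval F V (root F) φ ≡ true → eval F V (root F) (rt ℱ σ enc F ξ) ≡ true
    rt-implied rooted V φ-true =
      let ξ-sig , tr⇒ξ , _ = interp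
      in rt-true F∈ rooted (All.tabulate (ξ-sig _))
           (⇒-true⁻ (tr⇒ξ (uncurry′ V)) (trans (eval-tr F (uncurry′ V) (root F) φ) φ-true))

    rt-entails : ∀ ψ → All (_∈ σ) (sig ψ) → InLog ℱ (φ ⇒ₘ ψ) →
      ∀ {G} → G ∈ ℱ → Rooted G → ∀ V → eval G V (root G) (rt ℱ σ enc F ξ) ≡ true → eval G V (root G) ψ ≡ true
    rt-entails ψ ψ⊆σ φ⇒ψ G∈ rooted V rt-holds =
      let _ , _ , uniform = interp
          V′ , ξ-true , σ-equiv = rt-reflect F∈ G∈ rooted V rt-holds
          ξ⇒trψ = uniform (tr F (root F) ψ) (λ a a∈ _ → All.lookup (sig-tr F (root F) ψ ψ⊆σ) a∈)
                          (InLog⇒Taut-tr {φ = φ} {ψ} φ⇒ψ F∈)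
          ψ-true = trans (sym (eval-tr F (uncurry′ V′) (root F) ψ)) (⇒-true⁻ (ξ⇒trψ (uncurry′ V′)) ξ-true)
      in trans (sym (σ-equiv ψ ψ⊆σ)) ψ-true

theorem4p9 : (ℱ : List Frame) → ((F : Frame) → F ∈ ℱ → Rooted F) →
    (φ : Fm ℕ) (σ : List ℕ) → ((p : ℕ) → p ∈ σ → p ∈ sig φ) →
    (enc : Encoding) → IsEncoding ℱ σ enc →
    (ξ : (i : Fin (length ℱ)) → PL (ℕ × W (lookup ℱ i))) →
    ((i : Fin (length ℱ)) →
       IsUnifInterp (σ_ σ (lookup ℱ i)) (tr (lookup ℱ i) zero φ) (ξ i)) →
    IsStrongestImplicate ℱ σ φ
      (⋁ₘ (tabulate (λ i → rt ℱ σ enc (lookup ℱ i) (ξ i))))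
theorem4p9 ℱ rooted φ σ _ enc isEnc ξ interp = χ-sig , φ⇒χ , χ-strongest
  where
  χ : Fm ℕ
  χ = ⋁ₘ (tabulate (λ i → rt ℱ σ enc (lookup ℱ i) (ξ i)))

  χ-sig : ∀ p → p ∈ sig χ → p ∈ σ
  χ-sig p = All.lookup (sig-⋁ₘ (tabulate⁺ λ i → rt-sig isEnc {ξ = ξ i} (All.tabulate (proj₁ (interp i) _))))

  φ⇒χ : InLog ℱ (φ ⇒ₘ χ)
  φ⇒χ F F∈ V with index F∈ | lookup-index F∈
  ... | i | refl = ⇒-true⁺ λ φ-true →
    ⋁ₘ-true⁺ F V (∈-tabulate⁺ i) (rt-implied isEnc {ξ = ξ i} {φ} (interp i) F∈ (rooted F F∈) V φ-true)

  χ-strongest : ∀ ψ → (∀ p → p ∈ sig ψ → p ∈ σ) → InLog ℱ (φ ⇒ₘ ψ) → InLog ℱ (χ ⇒ₘ ψ)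
  χ-strongest ψ ψ⊆σ φ⇒ψ G G∈ V = ⇒-true⁺ λ χ-true →
    let i , rtᵢ-true = any-tabulate⁻ (⋁ₘ-true⁻ G V χ-true)
    in rt-entails isEnc {ξ = ξ i} {φ} (interp i) (∈-lookup i)
                  ψ (All.tabulate (ψ⊆σ _)) φ⇒ψ G∈ (rooted G G∈) V rtᵢ-true
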